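{- Let $A$ be the free zinbiel algebra over $\mathbb{Q}$ on the generators $0,1$, and let $\mathsf{A}_{1,0}\subset A$ be the span of the words starting with $1$ and ending with $0$. Let $C_{10,110}$ be the zinbiel sub-algebra of $\mathsf{A}_{1,0}$ generated by the words $10$ and $110$. Then $C_{10,110}$ is a free zinbiel algebra over $\mathbb{Q}$ on the generators $10$ and $110$.
   Context: A zinbiel algebra over a commutative ring $R$ is an $R$-module $L$ with a bilinear product $\prec$ satisfying $(x\prec y)\prec z = x\prec(y\prec z)+x\prec(z\prec y)$ for all $x,y,z$. The free zinbiel algebra over $\mathbb{Q}$ on a finite set $S$ has as basis the non-empty words in $S$. The product $w\prec w'$ of two words is the sum, with multiplicity, of the words in the shuffle product of $w$ and $w'$ whose first letter is the first letter of $w$. The subspace $\mathsf{A}_{1,0}$ is closed under $\prec$. -}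

module Defs where

open import Data.Bool using (Bool; true; false)
import Data.Bool.Properties as BoolP
open import Data.List using (List; []; _∷_; _++_; map; concatMap; foldr)
import Data.List.Properties as ListP
open import Data.List.NonEmpty using (List⁺; _∷_; toList)
open import Data.Product using (_×_; _,_)
open import Data.Rational using (ℚ; 0ℚ; 1ℚ; _+_; _*_)
open import Relation.Binary.Definitions using (DecidableEquality)
open import Relation.Binary.PropositionalEquality using (_≡_; refl)
open import Relation.Nullary using (yes; no)

shuffle : {X : Set} → List X → List X → List (List X)
shuffle [] v = v ∷ []
shuffle (x ∷ u) [] = (x ∷ u) ∷ []
shuffle (x ∷ u) (y ∷ v) =
  map (x ∷_) (shuffle u (y ∷ v)) ++ map (y ∷_) (shuffle (x ∷ u) v)

-- half-shuffle (zinbiel product) of two words:  (x u) ≺ v = x (u ш v),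
-- i.e. the shuffles of (x u) and v in which the first letter of (x u)
-- comes first.  Only ever applied to non-empty first arguments.
halfShuffle : {X : Set} → List X → List X → List (List X)
halfShuffle [] v = []
halfShuffle (x ∷ u) v = map (x ∷_) (shuffle u v)

-- Formal ℚ-linear combinations of words (a finitely supported element
-- of the vector space with basis the words), and their coefficients.

LinComb : Set → Set
LinComb W = List (ℚ × W)

coeff : {W : Set} → DecidableEquality W → LinComb W → W → ℚ
coeff _≟_ [] w = 0ℚ
coeff _≟_ ((q , u) ∷ c) w with u ≟ w
... | yes _ = q + coeff _≟_ c w
... | no  _ = coeff _≟_ c w

-- The free zinbiel algebra A over ℚ on the letters 0,1
-- (letters encoded as Bool: false = 0, true = 1).

WordA : Set
WordA = List Bool

_≟A_ : DecidableEquality WordA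
_≟A_ = ListP.≡-dec BoolP._≟_

_≺_ : LinComb WordA → LinComb WordA → LinComb WordA
c ≺ d = concatMap (λ { (p , u) →
          concatMap (λ { (q , v) → map (λ w → (p * q , w)) (halfShuffle u v) }) d }) c

data Gen : Set where
  g10 g110 : Gen

_≟Gen_ : DecidableEquality Gen
g10  ≟Gen g10  = yes refl
g10  ≟Gen g110 = no (λ ())
g110 ≟Gen g10  = no (λ ())
g110 ≟Gen g110 = yes refl

genWord : Gen → WordA
genWord g10  = true ∷ false ∷ []
genWord g110 = true ∷ true ∷ false ∷ []

-- Words in the free zinbiel algebra F on the generators {10, 110}:
-- non-empty words over Gen.  In F the word g₁ g₂ … gₙ equals
-- g₁ ≺ (g₂ ≺ (… ≺ gₙ)), so the unique zinbiel morphism φ : F → A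
-- with φ(g) = genWord g is given on basis words by:
φword' : Gen → List Gen → LinComb WordA
φword' g []      = (1ℚ , genWord g) ∷ []
φword' g (h ∷ t) = ((1ℚ , genWord g) ∷ []) ≺ φword' h t

φword : List⁺ Gen → LinComb WordA
φword (g ∷ t) = φword' g t

φ : LinComb (List⁺ Gen) → LinComb WordA
φ c = concatMap (λ { (q , u) → map (λ { (p , w) → (q * p , w) }) (φword u) }) c

_≟F_ : DecidableEquality (List⁺ Gen)
(g ∷ t) ≟F (h ∷ s) with ListP.≡-dec _≟Gen_ (g ∷ t) (h ∷ s)
... | yes refl = yes refl
... | no ne = no (λ { refl → ne refl })

IsZeroA : LinComb WordA → Set
IsZeroA c = ∀ w → coeff _≟A_ c w ≡ 0ℚ

IsZeroF : LinComb (List⁺ Gen) → Set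
IsZeroF c = ∀ w → coeff _≟F_ c w ≡ 0ℚ

-- Write spell u = g₁g₂…gₙ ∈ A for the concatenation of a word u = g₁ … gₙ over {10, 110}.
-- Then φ(u) = g₁ ≺ (g₂ ≺ (… ≺ gₙ)) is a sum of words, each with coefficient 1, one of which
-- is spell u and all of which lie above spell u in a suitable total order ⊑ on words; by
-- induction on n this reduces to the fact that g ≺ v is supported above g · spell(g₂…gₙ)
-- whenever v ⊒ spell(g₂…gₙ). As {10, 110} is a code, spell is injective, so the matrix of φ
-- is triangular with nonzero diagonal: in a relation Σ c_u φ(u) = 0, the coefficient of
-- spell u for a ⊑-minimal u is c_u times a positive number, hence c_u = 0.

{-# OPTIONS --safe #-}
module Submission where

open import Defs
open import Algebra.Bundles using (CommutativeMonoid)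
import Algebra.Properties.CommutativeSemigroup as CommutativeSemigroupProperties
open import Data.Bool using (true; false)
open import Data.List using (List; []; _∷_; _++_; map; concatMap; length; filter)
import Data.List.Properties as List
open import Data.List.NonEmpty using (List⁺; _∷_; toList)
open import Data.List.Relation.Unary.All as All using (All; []; _∷_)
import Data.List.Relation.Unary.All.Properties as All
open import Data.List.Relation.Unary.Any as Any using (Any; here; there)
open import Data.List.Membership.Propositional using (_∈_; _∉_; lose)
open import Data.List.Membership.Propositional.Properties using (∈-map⁺; ∈-++⁺ˡ; ∈-concatMap⁺)
import Data.List.Extrema
import Data.Nat as ℕ
open import Data.Nat.Induction using (<-wellFounded)
open import Data.Product using (Σ; _×_; _,_; proj₂)
open import Data.Empty using (⊥-elim)
open import Data.Sum using (_⊎_; inj₁; inj₂)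
open import Data.Rational using (ℚ; 0ℚ; 1ℚ; _+_; _*_; _≤_; _<_; 1/_; ≢-nonZero)
import Data.Rational.Properties as ℚ
open import Function using (_∘_; _on_)
open import Function.Definitions using (Injective)
open import Induction.WellFounded using (Acc; acc)
open import Level using (0ℓ)
open import Relation.Binary using (Rel; IsTotalOrder; TotalOrder)
open import Relation.Binary.Definitions using (DecidableEquality)
open import Relation.Unary using (Decidable)
import Relation.Binary.Construct.On as On
open import Relation.Binary.PropositionalEquality
open import Relation.Nullary using (yes; no; ¬_; ¬?)
open ≡-Reasoning
open CommutativeSemigroupProperties (CommutativeMonoid.commutativeSemigroup ℚ.+-0-commutativeMonoid)
  using () renaming (x∙yz≈y∙xz to +-left-comm)

p*q≡0⇒p≡0 : ∀ p {q} → q ≢ 0ℚ → p * q ≡ 0ℚ → p ≡ 0ℚ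
p*q≡0⇒p≡0 p {q} q≢0 pq≡0 = begin
  p                  ≡⟨ sym (ℚ.*-identityʳ p) ⟩
  p * 1ℚ             ≡⟨ cong (p *_) (sym (ℚ.*-inverseʳ q)) ⟩
  p * (q * 1/ q)     ≡⟨ sym (ℚ.*-assoc p q (1/ q)) ⟩
  p * q * 1/ q       ≡⟨ cong (_* 1/ q) pq≡0 ⟩
  0ℚ * 1/ q          ≡⟨ ℚ.*-zeroˡ (1/ q) ⟩
  0ℚ                 ∎
  where instance _ = ≢-nonZero q≢0

module LinearCombinations {W : Set} (_≟_ : DecidableEquality W) where

  coeff-++ : ∀ (c d : LinComb W) w → coeff _≟_ (c ++ d) w ≡ coeff _≟_ c w + coeff _≟_ d w
  coeff-++ [] d w = sym (ℚ.+-identityˡ _)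
  coeff-++ ((q , u) ∷ c) d w with u ≟ w
  ... | yes _ = trans (cong (q +_) (coeff-++ c d w)) (sym (ℚ.+-assoc q _ _))
  ... | no _ = coeff-++ c d w

  coeff-scale : ∀ (f : ℚ × W → ℚ × W) q → (∀ p u → f (p , u) ≡ (q * p , u)) →
                ∀ c w → coeff _≟_ (map f c) w ≡ q * coeff _≟_ c w
  coeff-scale f q f≗scale [] w = sym (ℚ.*-zeroʳ q)
  coeff-scale f q f≗scale ((p , u) ∷ c) w rewrite f≗scale p u with u ≟ w
  ... | yes _ = trans (cong (q * p +_) (coeff-scale f q f≗scale c w)) (sym (ℚ.*-distribˡ-+ q p _))
  ... | no _ = coeff-scale f q f≗scale c w

  formalSum : List W → LinComb W
  formalSum = map (1ℚ ,_)

  coeff-formalSum-nonneg : ∀ ws w → 0ℚ ≤ coeff _≟_ (formalSum ws) w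
  coeff-formalSum-nonneg [] w = ℚ.≤-refl
  coeff-formalSum-nonneg (u ∷ ws) w with u ≟ w
  ... | yes _ = ℚ.+-mono-≤ (ℚ.<⇒≤ (ℚ.positive⁻¹ 1ℚ)) (coeff-formalSum-nonneg ws w)
  ... | no _ = coeff-formalSum-nonneg ws w

  coeff-formalSum-∈ : ∀ {ws w} → w ∈ ws → 0ℚ < coeff _≟_ (formalSum ws) w
  coeff-formalSum-∈ {u ∷ ws} {w} w∈ with u ≟ w | w∈
  ... | yes _  | _         = ℚ.+-mono-<-≤ (ℚ.positive⁻¹ 1ℚ) (coeff-formalSum-nonneg ws w)
  ... | no u≢w | here refl = ⊥-elim (u≢w refl)
  ... | no _   | there w∈′ = coeff-formalSum-∈ w∈′

  coeff-formalSum-∉ : ∀ {ws w} → w ∉ ws → coeff _≟_ (formalSum ws) w ≡ 0ℚ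
  coeff-formalSum-∉ {[]} w∉ = refl
  coeff-formalSum-∉ {u ∷ ws} {w} w∉ with u ≟ w
  ... | yes refl = ⊥-elim (w∉ (here refl))
  ... | no _ = coeff-formalSum-∉ (w∉ ∘ there)

extendLinear : {V : Set} → (V → ℚ) → LinComb V → ℚ
extendLinear f [] = 0ℚ
extendLinear f ((q , v) ∷ c) = q * f v + extendLinear f c

module Triangular
  {V W : Set} (_≟_ : DecidableEquality V)
  {_⊑_ : Rel W 0ℓ} (isTotalOrder : IsTotalOrder _≡_ _⊑_)
  (key : V → W) (key-injective : Injective _≡_ _≡_ key)
  (K : V → W → ℚ)
  (K-diagonal : ∀ v → K v (key v) ≢ 0ℚ)
  (K-upper : ∀ v w → ¬ key v ⊑ w → K v w ≡ 0ℚ)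
  where

  open IsTotalOrder isTotalOrder using (antisym)

  totalOrder : TotalOrder 0ℓ 0ℓ 0ℓ
  totalOrder = record { isTotalOrder = isTotalOrder }

  open Data.List.Extrema totalOrder
    using (argmin; argmin-sel; f[argmin]≤f[⊤]; f[argmin]≤f[xs])

  imageCoeff : LinComb V → W → ℚ
  imageCoeff c w = extendLinear (λ v → K v w) c

  differs? : ∀ u → Decidable (λ (e : ℚ × V) → proj₂ e ≢ u)
  differs? u e = ¬? (proj₂ e ≟ u)

  without : V → LinComb V → LinComb V
  without u = filter (differs? u)

  minimalTerm : ∀ e es → Σ V λ u → Any ((_≡ u) ∘ proj₂) (e ∷ es) ×
                                    All (λ e′ → key u ⊑ key (proj₂ e′)) (e ∷ es)
  minimalTerm e es =
    proj₂ m , m∈ (argmin-sel keyOf e es) , f[argmin]≤f[⊤] {f = keyOf} e es ∷ f[argmin]≤f[xs] {f = keyOf} e es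
    where
    keyOf : ℚ × V → W
    keyOf = key ∘ proj₂
    m : ℚ × V
    m = argmin keyOf e es
    m∈ : m ≡ e ⊎ m ∈ es → Any ((_≡ proj₂ m) ∘ proj₂) (e ∷ es)
    m∈ (inj₁ m≡e) = here (cong proj₂ (sym m≡e))
    m∈ (inj₂ m∈es) = there (Any.map (cong proj₂ ∘ sym) m∈es)

  imageCoeff-split : ∀ u c w → imageCoeff c w ≡ coeff _≟_ c u * K u w + imageCoeff (without u c) w
  imageCoeff-split u [] w = sym (trans (cong (_+ 0ℚ) (ℚ.*-zeroˡ (K u w))) (ℚ.+-identityˡ 0ℚ))
  imageCoeff-split u ((q , v) ∷ c) w with v ≟ u
  ... | yes refl = begin
    q * K v w + imageCoeff c w                                     ≡⟨ cong (q * K v w +_) (imageCoeff-split v c w) ⟩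
    q * K v w + (coeff _≟_ c v * K v w + imageCoeff (without v c) w) ≡⟨ sym (ℚ.+-assoc (q * K v w) _ _) ⟩
    q * K v w + coeff _≟_ c v * K v w + imageCoeff (without v c) w   ≡⟨ cong (_+ _) (sym (ℚ.*-distribʳ-+ (K v w) q (coeff _≟_ c v))) ⟩
    (q + coeff _≟_ c v) * K v w + imageCoeff (without v c) w         ∎
  ... | no _ = begin
    q * K v w + imageCoeff c w                                     ≡⟨ cong (q * K v w +_) (imageCoeff-split u c w) ⟩
    q * K v w + (coeff _≟_ c u * K u w + imageCoeff (without u c) w) ≡⟨ +-left-comm (q * K v w) (coeff _≟_ c u * K u w) _ ⟩
    coeff _≟_ c u * K u w + (q * K v w + imageCoeff (without u c) w) ∎

  coeff-without : ∀ u c {v} → v ≢ u → coeff _≟_ (without u c) v ≡ coeff _≟_ c v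
  coeff-without u [] v≢u = refl
  coeff-without u ((q , v′) ∷ c) {v} v≢u with v′ ≟ u
  ... | yes refl with v′ ≟ v
  ...   | yes refl = ⊥-elim (v≢u refl)
  ...   | no _     = coeff-without u c v≢u
  coeff-without u ((q , v′) ∷ c) {v} v≢u | no _ with v′ ≟ v
  ...   | yes _ = cong (q +_) (coeff-without u c v≢u)
  ...   | no _  = coeff-without u c v≢u

  imageCoeff-vanishes : ∀ c w → All (λ e → K (proj₂ e) w ≡ 0ℚ) c → imageCoeff c w ≡ 0ℚ
  imageCoeff-vanishes [] w [] = refl
  imageCoeff-vanishes ((q , v) ∷ c) w (Kvw≡0 ∷ rest) = begin
    q * K v w + imageCoeff c w ≡⟨ cong₂ (λ x y → q * x + y) Kvw≡0 (imageCoeff-vanishes c w rest) ⟩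
    q * 0ℚ + 0ℚ               ≡⟨ cong (_+ 0ℚ) (ℚ.*-zeroʳ q) ⟩
    0ℚ                         ∎

  module _ (c : LinComb V) (u : V) (u-minimal : All (λ e → key u ⊑ key (proj₂ e)) c)
           (c≈0 : ∀ w → imageCoeff c w ≡ 0ℚ) where

    -- At the word key u only u itself contributes, since every other v in c has key v above key u.
    imageCoeff-without-at-key : imageCoeff (without u c) (key u) ≡ 0ℚ
    imageCoeff-without-at-key = imageCoeff-vanishes (without u c) (key u)
      (All.map (λ {e} → vanishes {e})
        (All.zip (All.all-filter (differs? u) c , All.filter⁺ (differs? u) u-minimal)))
      where
      vanishes : ∀ {e : ℚ × V} → proj₂ e ≢ u × key u ⊑ key (proj₂ e) → K (proj₂ e) (key u) ≡ 0ℚ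
      vanishes {_ , v} (v≢u , ku⊑kv) =
        K-upper v (key u) (λ kv⊑ku → v≢u (key-injective (antisym kv⊑ku ku⊑kv)))

    coeff-minimal≡0 : coeff _≟_ c u ≡ 0ℚ
    coeff-minimal≡0 = p*q≡0⇒p≡0 _ (K-diagonal u) (begin
      coeff _≟_ c u * K u (key u)                                  ≡⟨ sym (ℚ.+-identityʳ _) ⟩
      coeff _≟_ c u * K u (key u) + 0ℚ                             ≡⟨ cong (coeff _≟_ c u * K u (key u) +_) (sym imageCoeff-without-at-key) ⟩
      coeff _≟_ c u * K u (key u) + imageCoeff (without u c) (key u) ≡⟨ sym (imageCoeff-split u c (key u)) ⟩
      imageCoeff c (key u)                                         ≡⟨ c≈0 (key u) ⟩
      0ℚ                                                           ∎)

    imageCoeff-without≡0 : ∀ w → imageCoeff (without u c) w ≡ 0ℚ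
    imageCoeff-without≡0 w = begin
      imageCoeff (without u c) w                                   ≡⟨ sym (ℚ.+-identityˡ _) ⟩
      0ℚ + imageCoeff (without u c) w                              ≡⟨ cong (_+ imageCoeff (without u c) w) (sym (ℚ.*-zeroˡ (K u w))) ⟩
      0ℚ * K u w + imageCoeff (without u c) w                      ≡⟨ cong (λ x → x * K u w + imageCoeff (without u c) w) (sym coeff-minimal≡0) ⟩
      coeff _≟_ c u * K u w + imageCoeff (without u c) w           ≡⟨ sym (imageCoeff-split u c w) ⟩
      imageCoeff c w                                               ≡⟨ c≈0 w ⟩
      0ℚ                                                           ∎

  linearlyIndependent : ∀ c → (∀ w → imageCoeff c w ≡ 0ℚ) → ∀ v → coeff _≟_ c v ≡ 0ℚ
  linearlyIndependent c = go c (On.wellFounded length <-wellFounded c)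
    where
    go : ∀ c → Acc (ℕ._<_ on length) c → (∀ w → imageCoeff c w ≡ 0ℚ) → ∀ v → coeff _≟_ c v ≡ 0ℚ
    go [] _ _ _ = refl
    go (e ∷ es) (acc shorter) c≈0 v with minimalTerm e es
    ... | u , u∈c , u-minimal with v ≟ u
    ...   | yes refl = coeff-minimal≡0 (e ∷ es) v u-minimal c≈0
    ...   | no v≢u = begin
      coeff _≟_ (e ∷ es) v             ≡⟨ sym (coeff-without u (e ∷ es) v≢u) ⟩
      coeff _≟_ (without u (e ∷ es)) v ≡⟨ go (without u (e ∷ es)) (shorter without-shorter) rest≈0 v ⟩
      0ℚ                               ∎
      where
      rest≈0 : ∀ w → imageCoeff (without u (e ∷ es)) w ≡ 0ℚ
      rest≈0 = imageCoeff-without≡0 (e ∷ es) u u-minimal c≈0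
      without-shorter : length (without u (e ∷ es)) ℕ.< length (e ∷ es)
      without-shorter = List.filter-notAll (differs? u) (e ∷ es) (Any.map (λ v≡u v≢u → v≢u v≡u) u∈c)

infix 4 _⊑_

-- Lexicographic with 0 < 1, except that a word lies below each of its prefixes.
data _⊑_ : WordA → WordA → Set where
  stop : ∀ {a} → a ⊑ []
  next : ∀ {x a b} → a ⊑ b → x ∷ a ⊑ x ∷ b
  0<1  : ∀ {a b} → false ∷ a ⊑ true ∷ b

⊑-refl : ∀ {a} → a ⊑ a
⊑-refl {[]} = stop
⊑-refl {x ∷ a} = next ⊑-refl

⊑-trans : ∀ {a b c} → a ⊑ b → b ⊑ c → a ⊑ c
⊑-trans _ stop = stop
⊑-trans (next p) (next q) = next (⊑-trans p q)
⊑-trans (next p) 0<1 = 0<1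
⊑-trans 0<1 (next q) = 0<1

⊑-antisym : ∀ {a b} → a ⊑ b → b ⊑ a → a ≡ b
⊑-antisym stop stop = refl
⊑-antisym (next p) (next q) = cong (_ ∷_) (⊑-antisym p q)

⊑-total : ∀ a b → a ⊑ b ⊎ b ⊑ a
⊑-total a [] = inj₁ stop
⊑-total [] (y ∷ b) = inj₂ stop
⊑-total (false ∷ a) (true ∷ b) = inj₁ 0<1
⊑-total (true ∷ a) (false ∷ b) = inj₂ 0<1
⊑-total (false ∷ a) (false ∷ b) = Data.Sum.map next next (⊑-total a b)
⊑-total (true ∷ a) (true ∷ b) = Data.Sum.map next next (⊑-total a b)

⊑-isTotalOrder : IsTotalOrder _≡_ _⊑_
⊑-isTotalOrder = record
  { isPartialOrder = record
    { isPreorder = record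
      { isEquivalence = isEquivalence
      ; reflexive = λ { refl → ⊑-refl }
      ; trans = ⊑-trans
      }
    ; antisym = ⊑-antisym
    }
  ; total = ⊑-total
  }

spell : List Gen → WordA
spell = concatMap genWord

spell-injective : ∀ s t → spell s ≡ spell t → s ≡ t
spell-injective [] [] _ = refl
spell-injective [] (g10 ∷ t) ()
spell-injective [] (g110 ∷ t) ()
spell-injective (g10 ∷ s) [] ()
spell-injective (g110 ∷ s) [] ()
spell-injective (g10 ∷ s) (g110 ∷ t) ()
spell-injective (g110 ∷ s) (g10 ∷ t) ()
spell-injective (g10 ∷ s) (g10 ∷ t) eq =
  cong (g10 ∷_) (spell-injective s t (List.∷-injectiveʳ (List.∷-injectiveʳ eq)))
spell-injective (g110 ∷ s) (g110 ∷ t) eq =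
  cong (g110 ∷_) (spell-injective s t (List.∷-injectiveʳ (List.∷-injectiveʳ (List.∷-injectiveʳ eq))))

leadingWord : List⁺ Gen → WordA
leadingWord = spell ∘ toList

leadingWord-injective : Injective _≡_ _≡_ leadingWord
leadingWord-injective {g ∷ s} {h ∷ t} eq with spell-injective (g ∷ s) (h ∷ t) eq
... | refl = refl

expand : Gen → List Gen → List WordA
expand g [] = genWord g ∷ []
expand g (h ∷ t) = concatMap (halfShuffle (genWord g)) (expand h t)

open LinearCombinations _≟A_

≺-cons : ∀ u q v d → ((1ℚ , u) ∷ []) ≺ ((q , v) ∷ d) ≡
                     map (λ w → (1ℚ * q , w)) (halfShuffle u v) ++ ((1ℚ , u) ∷ []) ≺ d
≺-cons u q v d = List.++-assoc (map (λ w → (1ℚ * q , w)) (halfShuffle u v)) _ []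

formalSum-≺ : ∀ u vs → ((1ℚ , u) ∷ []) ≺ formalSum vs ≡ formalSum (concatMap (halfShuffle u) vs)
formalSum-≺ u [] = refl
formalSum-≺ u (v ∷ vs) = begin
  ((1ℚ , u) ∷ []) ≺ formalSum (v ∷ vs)                              ≡⟨ ≺-cons u 1ℚ v (formalSum vs) ⟩
  formalSum (halfShuffle u v) ++ ((1ℚ , u) ∷ []) ≺ formalSum vs     ≡⟨ cong (formalSum (halfShuffle u v) ++_) (formalSum-≺ u vs) ⟩
  formalSum (halfShuffle u v) ++ formalSum (concatMap (halfShuffle u) vs) ≡⟨ sym (List.map-++ (1ℚ ,_) (halfShuffle u v) _) ⟩
  formalSum (concatMap (halfShuffle u) (v ∷ vs))                    ∎

φword'≡formalSum-expand : ∀ g t → φword' g t ≡ formalSum (expand g t)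
φword'≡formalSum-expand g [] = refl
φword'≡formalSum-expand g (h ∷ t) = begin
  ((1ℚ , genWord g) ∷ []) ≺ φword' h t              ≡⟨ cong (((1ℚ , genWord g) ∷ []) ≺_) (φword'≡formalSum-expand h t) ⟩
  ((1ℚ , genWord g) ∷ []) ≺ formalSum (expand h t)  ≡⟨ formalSum-≺ (genWord g) (expand h t) ⟩
  formalSum (expand g (h ∷ t))                      ∎

++∈shuffle : ∀ {X : Set} (u v : List X) → u ++ v ∈ shuffle u v
++∈shuffle [] v = here refl
++∈shuffle (x ∷ u) [] = here (cong (x ∷_) (List.++-identityʳ u))
++∈shuffle (x ∷ u) (y ∷ v) = ∈-++⁺ˡ (∈-map⁺ (x ∷_) (++∈shuffle u (y ∷ v)))

genWord-++∈halfShuffle : ∀ g v → genWord g ++ v ∈ halfShuffle (genWord g) v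
genWord-++∈halfShuffle g10 v = ∈-map⁺ (true ∷_) (++∈shuffle (false ∷ []) v)
genWord-++∈halfShuffle g110 v = ∈-map⁺ (true ∷_) (++∈shuffle (true ∷ false ∷ []) v)

spell∈expand : ∀ g t → spell (g ∷ t) ∈ expand g t
spell∈expand g [] = here (List.++-identityʳ (genWord g))
spell∈expand g (h ∷ t) =
  ∈-concatMap⁺ (halfShuffle (genWord g)) (lose (spell∈expand h t) (genWord-++∈halfShuffle g (spell (h ∷ t))))

∷-above : ∀ {x a ws} → All (a ⊑_) ws → All (x ∷ a ⊑_) (map (x ∷_) ws)
∷-above = All.map⁺ ∘ All.map next

0∷-below-1∷ : ∀ {a} ws → All (false ∷ a ⊑_) (map (true ∷_) ws)
0∷-below-1∷ ws = All.map⁺ (All.universal (λ _ → 0<1) ws)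

shuffle0-above : ∀ {a v} → true ∷ a ⊑ v → All (false ∷ true ∷ a ⊑_) (shuffle (false ∷ []) v)
shuffle0-above stop = next stop ∷ []
shuffle0-above {v = true ∷ v} (next p) = next (next p) ∷ 0∷-below-1∷ (shuffle (false ∷ []) v)

shuffle10-above-1∷ : ∀ {a v} → true ∷ a ⊑ true ∷ v →
                     All (false ∷ true ∷ a ⊑_) (shuffle (true ∷ false ∷ []) v) →
                     All (true ∷ false ∷ true ∷ a ⊑_) (shuffle (true ∷ false ∷ []) (true ∷ v))
shuffle10-above-1∷ p rest = All.++⁺ (∷-above (shuffle0-above p)) (∷-above rest)

mutual
  shuffle10-above : ∀ t {v} → spell t ⊑ v →
                    All (true ∷ false ∷ spell t ⊑_) (shuffle (true ∷ false ∷ []) v)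
  shuffle10-above t {[]} _ = next (next stop) ∷ []
  shuffle10-above [] {_ ∷ _} ()
  shuffle10-above (g10 ∷ t) (next p) =
    shuffle10-above-1∷ (next p) (shuffle10-above-tail (g10 ∷ t) (next p))
  shuffle10-above (g110 ∷ t) (next p) =
    shuffle10-above-1∷ (next p) (shuffle10-above-tail (g110 ∷ t) (next p))

  shuffle10-above-tail : ∀ t {v} → spell t ⊑ true ∷ v →
                         All (false ∷ spell t ⊑_) (shuffle (true ∷ false ∷ []) v)
  shuffle10-above-tail t {[]} _ = 0<1 ∷ []
  shuffle10-above-tail t {true ∷ v} _ =
    All.++⁺ (0∷-below-1∷ (shuffle (false ∷ []) (true ∷ v))) (0∷-below-1∷ (shuffle (true ∷ false ∷ []) v))
  shuffle10-above-tail (g10 ∷ t) {false ∷ v} (next (next p)) =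
    All.++⁺ (0∷-below-1∷ (shuffle (false ∷ []) (false ∷ v))) (∷-above (shuffle10-above t p))
  shuffle10-above-tail (g110 ∷ t) {false ∷ v} (next ())

halfShuffle-above : ∀ g h t {v} → spell (h ∷ t) ⊑ v →
                    All (spell (g ∷ h ∷ t) ⊑_) (halfShuffle (genWord g) v)
halfShuffle-above g10 g10 t p = ∷-above (shuffle0-above p)
halfShuffle-above g10 g110 t p = ∷-above (shuffle0-above p)
halfShuffle-above g110 h t p = ∷-above (shuffle10-above (h ∷ t) p)

expand-above : ∀ g t → All (spell (g ∷ t) ⊑_) (expand g t)
expand-above g10 [] = ⊑-refl ∷ []
expand-above g110 [] = ⊑-refl ∷ []
expand-above g (h ∷ t) = All.concat⁺ (All.map⁺ (All.map (halfShuffle-above g h t) (expand-above h t)))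

coeff-φword-leadingWord≢0 : ∀ v → coeff _≟A_ (φword v) (leadingWord v) ≢ 0ℚ
coeff-φword-leadingWord≢0 (g ∷ t) rewrite φword'≡formalSum-expand g t =
  ≢-sym (ℚ.<⇒≢ (coeff-formalSum-∈ (spell∈expand g t)))

coeff-φword-below-leadingWord : ∀ v w → ¬ leadingWord v ⊑ w → coeff _≟A_ (φword v) w ≡ 0ℚ
coeff-φword-below-leadingWord (g ∷ t) w ¬lead⊑w rewrite φword'≡formalSum-expand g t =
  coeff-formalSum-∉ (λ w∈ → ¬lead⊑w (All.lookup (expand-above g t) w∈))

coeff-φ : ∀ c w → coeff _≟A_ (φ c) w ≡ extendLinear (λ v → coeff _≟A_ (φword v) w) c
coeff-φ [] w = refl
coeff-φ ((q , v) ∷ c) w = begin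
  coeff _≟A_ (φ ((q , v) ∷ c)) w                                ≡⟨ coeff-++ (map _ (φword v)) (φ c) w ⟩
  coeff _≟A_ (map _ (φword v)) w + coeff _≟A_ (φ c) w           ≡⟨ cong₂ _+_ (coeff-scale _ q (λ _ _ → refl) (φword v) w) (coeff-φ c w) ⟩
  q * coeff _≟A_ (φword v) w + extendLinear (λ v → coeff _≟A_ (φword v) w) c ∎

mainTheorem3 : (c : LinComb (List⁺ Gen)) → IsZeroA (φ c) → IsZeroF c
mainTheorem3 c φc≡0 = linearlyIndependent c (λ w → trans (sym (coeff-φ c w)) (φc≡0 w))
  where
  open Triangular _≟F_ ⊑-isTotalOrder leadingWord leadingWord-injective
         (λ v → coeff _≟A_ (φword v)) coeff-φword-leadingWord≢0 coeff-φword-below-leadingWord
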